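{- Let $n,k$ be positive integers and $s_1,s_2,t_1,t_2 \in \mathbb{Z}_k$ with $t_1\neq 0$, $t_2 \neq 0$, $t_1\neq t_2$. Suppose $v \in Y(s_1,t_1)$ and $w\in Y(s_2,t_2)$ are adjacent in $H(n,k)$. Then: (i) if $\ell(v)>\ell(w)$, then $s_1-s_2\equiv t_1 \pmod k$; (ii) if $\ell(v)<\ell(w)$, then $s_2 - s_1 \equiv t_2 \pmod k$; (iii) if $\ell(v)=\ell(w)$, then $s_1-s_2\equiv t_1-t_2 \pmod k$.
   Context: The Hamming graph $H(n,k)$ has vertex set $\mathbb{Z}_k^n$ with $\mathbb{Z}_k=\{0,1,\dots,k-1\}$, two vertices being adjacent iff they differ in exactly one coordinate; $v(i)$ is the $i$-th coordinate of $v$ and arithmetic is modulo $k$. For $v \neq (0,\dots,0)$, $\ell(v)$ is the largest index $i$ with $v(i)\neq 0$. For $s,t\in\mathbb{Z}_k$ with $t\neq 0$, $Y(s,t)$ is the set of nonzero vertices $v$ with $\sum_{i=1}^n v(i)\equiv s \pmod k$ and $v(\ell(v)) = t$. -}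

module Defs where

open import Data.Nat using (ℕ; zero; suc; _+_; _∸_; NonZero)
open import Data.Nat.DivMod using (_%_; m%n<n)
open import Data.Fin using (Fin; toℕ; fromℕ<; zero; suc)
open import Data.Vec using (Vec; []; _∷_; lookup; foldr; replicate)
open import Data.Bool using (Bool; true; false; if_then_else_)
open import Data.Maybe using (Maybe; just; nothing)
open import Relation.Binary.PropositionalEquality using (_≡_)
open import Relation.Nullary using (¬_)
open import Data.Product using (_×_; ∃-syntax)

module _ {k : ℕ} .{{_ : NonZero k}} where

  mod : ℕ → Fin k
  mod a = fromℕ< (m%n<n a k)

  _+ₖ_ : Fin k → Fin k → Fin k
  a +ₖ b = mod (toℕ a + toℕ b)

  _-ₖ_ : Fin k → Fin k → Fin k
  a -ₖ b = mod (toℕ a + (k ∸ toℕ b))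

  0ₖ : Fin k
  0ₖ = mod 0

Vertex : ℕ → ℕ → Set
Vertex n k = Vec (Fin k) n

coordSum : ∀ {n k} .{{_ : NonZero k}} → Vertex n k → Fin k
coordSum = foldr _ _+ₖ_ 0ₖ

zeroVertex : ∀ n k .{{_ : NonZero k}} → Vertex n k
zeroVertex n k = replicate n 0ₖ

Adjacent : ∀ {n k} → Vertex n k → Vertex n k → Set
Adjacent {n} v w =
  ∃[ i ] (¬ lookup v i ≡ lookup w i
          × (∀ (j : Fin n) → ¬ j ≡ i → lookup v j ≡ lookup w j))

-- ℓ(v): the largest index i with v(i) ≠ 0; nothing iff v is the zero vertex.
-- Indices are Fin n (0-based, i.e. shifted by one), which preserves order.
isZeroₖ : ∀ {k} → Fin k → Bool
isZeroₖ zero    = true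
isZeroₖ (suc _) = false

ℓ : ∀ {n k} → Vertex n k → Maybe (Fin n)
ℓ [] = nothing
ℓ (x ∷ v) with ℓ v
... | just i  = just (suc i)
... | nothing = if isZeroₖ x then nothing else just zero

InY : ∀ {n k} .{{_ : NonZero k}} → Vertex n k → Fin k → Fin k → Set
InY v s t = ¬ v ≡ zeroVertex _ _ × coordSum v ≡ s
  × ∃[ i ] (ℓ v ≡ just i × lookup v i ≡ t)

{-# OPTIONS --safe #-}
-- Adjacent vertices differ in exactly one coordinate q, so their coordinate sums differ by
-- v(q) - w(q).  Beyond ℓ(v) all coordinates of v vanish: if ℓ(w) < ℓ(v) the coordinate
-- q = ℓ(v) is the one where v (value t₁) and w (value 0) differ, symmetrically if ℓ(v) < ℓ(w),
-- and if ℓ(v) = ℓ(w) then q is that common index, where the values are t₁ ≠ t₂.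
module Submission where

open import Defs
open import Data.Nat using (ℕ; NonZero; _+_; _*_; _∸_; _%_; _/_; suc; s<s⁻¹)
open import Data.Nat.Properties using (+-assoc; +-comm; m+[n∸m]≡n; <⇒≤)
open import Data.Nat.DivMod
  using (m%n<n; m%n≤n; m%n%n≡m%n; m<n⇒m%n≡m; [m+n]%n≡m%n; [m+kn]%n≡m%n; %-distribˡ-+; m≡m%n+[m/n]*n)
open import Data.Nat.Tactic.RingSolver using (solve-∀)
open import Data.Fin using (Fin; zero; suc; _<_; toℕ)
open import Data.Fin.Properties using (toℕ-injective; toℕ-fromℕ<; fromℕ<-cong; toℕ<n; suc-injective; _≟_)
open import Data.Vec using (Vec; []; _∷_; lookup; map; sum)
open import Data.Vec.Properties using (tabulate∘lookup; tabulate-cong)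
open import Data.Maybe using (just; nothing)
open import Data.Maybe.Properties using (just-injective)
open import Data.Product using (_×_; _,_)
open import Relation.Binary.PropositionalEquality
open import Function using (_∘_)
open import Relation.Nullary using (¬_; yes; no; contradiction)

private
  variable
    A : Set
    n : ℕ

module _ {k : ℕ} .{{_ : NonZero k}} where

  toℕ-mod : ∀ a → toℕ (mod {k} a) ≡ a % k
  toℕ-mod a = toℕ-fromℕ< (m%n<n a k)

  mod-cong-% : ∀ {a b} → a % k ≡ b % k → mod {k} a ≡ mod b
  mod-cong-% {a} {b} eq = fromℕ<-cong (a % k) (b % k) eq (m%n<n a k) (m%n<n b k)

  mod-toℕ : (x : Fin k) → mod (toℕ x) ≡ x
  mod-toℕ x = toℕ-injective (trans (toℕ-mod (toℕ x)) (m<n⇒m%n≡m (toℕ<n x)))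

  [m%k+n]%k≡[m+n]%k : ∀ m o → (m % k + o) % k ≡ (m + o) % k
  [m%k+n]%k≡[m+n]%k m o = begin
    (m % k + o) % k         ≡⟨ %-distribˡ-+ (m % k) o k ⟩
    (m % k % k + o % k) % k ≡⟨ cong (λ z → (z + o % k) % k) (m%n%n≡m%n m k) ⟩
    (m % k + o % k) % k     ≡⟨ %-distribˡ-+ m o k ⟨
    (m + o) % k             ∎
    where open ≡-Reasoning

  -- Adding k ∸ b % k cancels b modulo k, which is how _-ₖ_ avoids truncated subtraction.
  mod-ₖ-mod : ∀ {a b c} → (c + b) % k ≡ a % k → mod a -ₖ mod b ≡ mod c
  mod-ₖ-mod {a} {b} {c} eq = mod-cong-% (begin
    (toℕ (mod {k} a) + (k ∸ toℕ (mod {k} b))) % k ≡⟨ cong₂ (λ x y → (x + (k ∸ y)) % k) (toℕ-mod a) (toℕ-mod b) ⟩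
    (a % k + (k ∸ b % k)) % k                     ≡⟨ cong (λ z → (z + (k ∸ b % k)) % k) eq ⟨
    ((c + b) % k + (k ∸ b % k)) % k               ≡⟨ [m%k+n]%k≡[m+n]%k (c + b) (k ∸ b % k) ⟩
    (c + b + (k ∸ b % k)) % k                     ≡⟨ cong (λ z → (c + z + (k ∸ b % k)) % k) (m≡m%n+[m/n]*n b k) ⟩
    (c + (b % k + b / k * k) + (k ∸ b % k)) % k   ≡⟨ cong (_% k) (regroup c (b % k) (b / k * k) (k ∸ b % k)) ⟩
    (c + (b % k + (k ∸ b % k)) + b / k * k) % k   ≡⟨ cong (λ z → (c + z + b / k * k) % k) (m+[n∸m]≡n (m%n≤n b k)) ⟩
    (c + k + b / k * k) % k                       ≡⟨ [m+kn]%n≡m%n (c + k) (b / k) k ⟩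
    (c + k) % k                                   ≡⟨ [m+n]%n≡m%n c k ⟩
    c % k                                         ∎)
    where
    open ≡-Reasoning
    regroup : ∀ c r q x → c + (r + q) + x ≡ c + (r + x) + q
    regroup = solve-∀

  coordSum≡mod-sum : (v : Vertex n k) → coordSum v ≡ mod (sum (map toℕ v))
  coordSum≡mod-sum [] = refl
  coordSum≡mod-sum (x ∷ v) = mod-cong-% (begin
    (toℕ x + toℕ (coordSum v)) % k ≡⟨ cong (λ z → (toℕ x + toℕ z) % k) (coordSum≡mod-sum v) ⟩
    (toℕ x + toℕ (mod {k} s)) % k  ≡⟨ cong (λ z → (toℕ x + z) % k) (toℕ-mod s) ⟩
    (toℕ x + s % k) % k            ≡⟨ cong (_% k) (+-comm (toℕ x) (s % k)) ⟩
    (s % k + toℕ x) % k            ≡⟨ [m%k+n]%k≡[m+n]%k s (toℕ x) ⟩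
    (s + toℕ x) % k                ≡⟨ cong (_% k) (+-comm s (toℕ x)) ⟩
    (toℕ x + s) % k                ∎)
    where
    open ≡-Reasoning
    s = sum (map toℕ v)

-ₖ-zeroʳ : ∀ {k} (x : Fin (suc k)) → x -ₖ zero ≡ x
-ₖ-zeroʳ {k} x = trans (mod-cong-% {a = toℕ x + suc k} {toℕ x} ([m+n]%n≡m%n (toℕ x) (suc k))) (mod-toℕ x)

AgreeOff : Vec A n → Vec A n → Fin n → Set
AgreeOff {n = n} v w p = ∀ (j : Fin n) → ¬ j ≡ p → lookup v j ≡ lookup w j

AgreeOff-sym : {v w : Vec A n} {p : Fin n} → AgreeOff v w p → AgreeOff w v p
AgreeOff-sym agree j j≢p = sym (agree j j≢p)

Adjacent⇒AgreeOff : ∀ {k} {v w : Vertex n k} {q : Fin n} →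
  Adjacent v w → ¬ lookup v q ≡ lookup w q → AgreeOff v w q
Adjacent⇒AgreeOff {q = q} (p , _ , agree) vq≢wq with q ≟ p
... | yes refl = agree
... | no q≢p   = contradiction (agree q q≢p) vq≢wq

sum-map-agreeOff : (f : A → ℕ) (v w : Vec A n) (p : Fin n) → AgreeOff v w p →
  sum (map f v) + f (lookup w p) ≡ sum (map f w) + f (lookup v p)
sum-map-agreeOff f (x ∷ v) (y ∷ w) zero agree = begin
  f x + sum (map f v) + f y ≡⟨ cong (λ u → f x + sum (map f u) + f y) v≡w ⟩
  f x + sum (map f w) + f y ≡⟨ swap (f x) (sum (map f w)) (f y) ⟩
  f y + sum (map f w) + f x ∎
  where
  open ≡-Reasoning
  v≡w : v ≡ w
  v≡w = trans (sym (tabulate∘lookup v))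
          (trans (tabulate-cong (λ j → agree (suc j) λ ())) (tabulate∘lookup w))
  swap : ∀ a b c → a + b + c ≡ c + b + a
  swap = solve-∀
sum-map-agreeOff f (x ∷ v) (y ∷ w) (suc p) agree = begin
  f x + sum (map f v) + f (lookup w p)   ≡⟨ +-assoc (f x) _ _ ⟩
  f x + (sum (map f v) + f (lookup w p)) ≡⟨ cong₂ _+_ (cong f (agree zero λ ())) tails ⟩
  f y + (sum (map f w) + f (lookup v p)) ≡⟨ +-assoc (f y) _ _ ⟨
  f y + sum (map f w) + f (lookup v p)   ∎
  where
  open ≡-Reasoning
  tails = sum-map-agreeOff f v w p (λ j j≢p → agree (suc j) (j≢p ∘ suc-injective))

coordSum-agreeOff : ∀ {k} .{{_ : NonZero k}} (v w : Vertex n k) (p : Fin n) → AgreeOff v w p →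
  coordSum v -ₖ coordSum w ≡ lookup v p -ₖ lookup w p
coordSum-agreeOff {k = k} v w p agree = begin
  coordSum v -ₖ coordSum w ≡⟨ cong₂ _-ₖ_ (coordSum≡mod-sum v) (coordSum≡mod-sum w) ⟩
  mod Σv -ₖ mod Σw         ≡⟨ mod-ₖ-mod (trans (cong (_% k) shift) ([m+n]%n≡m%n Σv k)) ⟩
  mod (x + (k ∸ y))        ∎
  where
  open ≡-Reasoning
  Σv = sum (map toℕ v)
  Σw = sum (map toℕ w)
  x = toℕ (lookup v p)
  y = toℕ (lookup w p)
  shift : x + (k ∸ y) + Σw ≡ Σv + k
  shift = begin
    x + (k ∸ y) + Σw   ≡⟨ rotate x (k ∸ y) Σw ⟩
    Σw + x + (k ∸ y)   ≡⟨ cong (_+ (k ∸ y)) (sum-map-agreeOff toℕ v w p agree) ⟨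
    Σv + y + (k ∸ y)   ≡⟨ +-assoc Σv y (k ∸ y) ⟩
    Σv + (y + (k ∸ y)) ≡⟨ cong (Σv +_) (m+[n∸m]≡n (<⇒≤ (toℕ<n (lookup w p)))) ⟩
    Σv + k             ∎
    where
    rotate : ∀ a b c → a + b + c ≡ c + a + b
    rotate = solve-∀

Adjacent-sym : ∀ {k} (v w : Vertex n k) → Adjacent v w → Adjacent w v
Adjacent-sym v w (p , vp≢wp , agree) = p , vp≢wp ∘ sym , AgreeOff-sym {v = v} {w} agree

coordSum-adjacent : ∀ {k} .{{_ : NonZero k}} (v w : Vertex n k) {q : Fin n} {a b : Fin k} →
  Adjacent v w → lookup v q ≡ a → lookup w q ≡ b → ¬ a ≡ b → coordSum v -ₖ coordSum w ≡ a -ₖ b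
coordSum-adjacent v w {q} adj refl refl a≢b =
  coordSum-agreeOff v w q (Adjacent⇒AgreeOff {v = v} {w} adj a≢b)

lookup-ℓ≡nothing : ∀ {k} (v : Vertex n (suc k)) → ℓ v ≡ nothing → ∀ m → lookup v m ≡ zero
lookup-ℓ≡nothing (x ∷ v) ℓv≡nothing m with ℓ v in ℓv
lookup-ℓ≡nothing (x ∷ v) () m | just _
lookup-ℓ≡nothing (zero ∷ v) _ zero | nothing = refl
lookup-ℓ≡nothing (zero ∷ v) _ (suc m) | nothing = lookup-ℓ≡nothing v ℓv m
lookup-ℓ≡nothing (suc x ∷ v) () m | nothing

lookup-beyond-ℓ : ∀ {k} (v : Vertex n (suc k)) {i m : Fin n} → ℓ v ≡ just i → i < m → lookup v m ≡ zero
lookup-beyond-ℓ (x ∷ v) ℓv≡i i<m with ℓ v in ℓv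
lookup-beyond-ℓ (x ∷ v) {m = zero} refl () | just _
lookup-beyond-ℓ (x ∷ v) {m = suc m} refl i<m | just _ = lookup-beyond-ℓ v ℓv (s<s⁻¹ i<m)
lookup-beyond-ℓ (zero ∷ v) () i<m | nothing
lookup-beyond-ℓ (suc x ∷ v) {m = zero} refl () | nothing
lookup-beyond-ℓ (suc x ∷ v) {m = suc m} refl i<m | nothing = lookup-ℓ≡nothing v ℓv m

InY⇒lookup-ℓ : ∀ {k} .{{_ : NonZero k}} {v : Vertex n k} {s t : Fin k} {i : Fin n} →
  InY v s t → ℓ v ≡ just i → lookup v i ≡ t
InY⇒lookup-ℓ {v = v} {t = t} (_ , _ , i′ , ℓv≡i′ , vi′≡t) ℓv≡i =
  subst (λ j → lookup v j ≡ t) (just-injective (trans (sym ℓv≡i′) ℓv≡i)) vi′≡t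

lemma13 : (n k : ℕ) .{{_ : NonZero n}} .{{_ : NonZero k}} → (s₁ s₂ t₁ t₂ : Fin k) →
    ¬ t₁ ≡ 0ₖ → ¬ t₂ ≡ 0ₖ → ¬ t₁ ≡ t₂ →
    (v w : Vertex n k) → InY v s₁ t₁ → InY w s₂ t₂ → Adjacent v w →
    (i j : Fin n) → ℓ v ≡ just i → ℓ w ≡ just j →
    (j < i → s₁ -ₖ s₂ ≡ t₁)
    × (i < j → s₂ -ₖ s₁ ≡ t₂)
    × (i ≡ j → s₁ -ₖ s₂ ≡ t₁ -ₖ t₂)
lemma13 n (suc k) s₁ s₂ t₁ t₂ t₁≢0 t₂≢0 t₁≢t₂ v w
        v∈Y@(_ , sv≡s₁ , _) w∈Y@(_ , sw≡s₂ , _) adj i j ℓv≡i ℓw≡j =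
  ℓw<ℓv , ℓv<ℓw , ℓv≡ℓw
  where
  open ≡-Reasoning
  vi≡t₁ = InY⇒lookup-ℓ v∈Y ℓv≡i
  wj≡t₂ = InY⇒lookup-ℓ w∈Y ℓw≡j
  ℓw<ℓv : j < i → s₁ -ₖ s₂ ≡ t₁
  ℓw<ℓv j<i = begin
    s₁ -ₖ s₂                 ≡⟨ cong₂ _-ₖ_ sv≡s₁ sw≡s₂ ⟨
    coordSum v -ₖ coordSum w ≡⟨ coordSum-adjacent v w adj vi≡t₁ (lookup-beyond-ℓ w ℓw≡j j<i) t₁≢0 ⟩
    t₁ -ₖ zero               ≡⟨ -ₖ-zeroʳ t₁ ⟩
    t₁                       ∎
  ℓv<ℓw : i < j → s₂ -ₖ s₁ ≡ t₂
  ℓv<ℓw i<j = begin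
    s₂ -ₖ s₁                 ≡⟨ cong₂ _-ₖ_ sw≡s₂ sv≡s₁ ⟨
    coordSum w -ₖ coordSum v ≡⟨ coordSum-adjacent w v (Adjacent-sym v w adj)
                                  wj≡t₂ (lookup-beyond-ℓ v ℓv≡i i<j) t₂≢0 ⟩
    t₂ -ₖ zero               ≡⟨ -ₖ-zeroʳ t₂ ⟩
    t₂                       ∎
  ℓv≡ℓw : i ≡ j → s₁ -ₖ s₂ ≡ t₁ -ₖ t₂
  ℓv≡ℓw refl = begin
    s₁ -ₖ s₂                 ≡⟨ cong₂ _-ₖ_ sv≡s₁ sw≡s₂ ⟨
    coordSum v -ₖ coordSum w ≡⟨ coordSum-adjacent v w adj vi≡t₁ wj≡t₂ t₁≢t₂ ⟩
    t₁ -ₖ t₂                 ∎
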